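{- Let $G$ be a leaf power. If there is an integer $r$ such that every RS model of $G$ contains a subtree of radius at least $r$, then $G$ is not a $k$-leaf power for any $k<r$.
   Context: A graph $G$ is a $k$-leaf power ($k$ a positive integer) if there exist a tree $T$ and a bijection $\tau$ from $V(G)$ to the leaves of $T$ such that $uv\in E(G)$ iff $\tau(u),\tau(v)$ have distance at most $k$ in $T$; $G$ is a leaf power if it is a $k$-leaf power for some $k$. A subtree model of $G$ is a pair $(T,\mathcal{S})$ with $T$ a tree and $\mathcal{S}=\{S_v\mid v\in V(G)\}$ a family of connected subtrees of $T$ such that $S_u\cap S_v\neq\emptyset$ iff $uv\in E(G)$. An RS (radial subtree) model of $G$ is a subtree model $(T,\mathcal{S})$ in which for each $v\in V(G)$ there are a node $c_v\in V(T)$ (center) and an integer $r_v\ge 0$ (radius) such that $S_v$ is the subtree of $T$ induced by all nodes at distance at most $r_v$ from $c_v$. Trees are assumed to have at least three leaves. -}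

module Defs where

open import Data.Nat using (ℕ; zero; suc; _≤_)
open import Data.Fin using (Fin)
open import Data.List using (List; _∷_; []; _++_; length)
open import Data.List.Relation.Unary.Linked using (Linked)
open import Data.List.Relation.Unary.Unique.Propositional using (Unique)
open import Data.Product using (Σ; ∃; ∃-syntax; _×_; _,_)
open import Data.Empty using (⊥)
open import Relation.Nullary using (¬_)
open import Relation.Binary.PropositionalEquality using (_≡_; _≢_)
open import Function.Bundles using (_⇔_)
open import Function.Definitions using (Injective)

record Graph (n : ℕ) : Set₁ where
  field
    Adj    : Fin n → Fin n → Set
    sym    : ∀ {u v} → Adj u v → Adj v u
    irrefl : ∀ {v} → ¬ Adj v v
open Graph public

data Walk {n : ℕ} (G : Graph n) : Fin n → Fin n → ℕ → Set where
  nil  : ∀ {x} → Walk G x x 0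
  cons : ∀ {x z y ℓ} → Adj G x z → Walk G z y ℓ → Walk G x y (suc ℓ)

DistLe : ∀ {n} → Graph n → Fin n → Fin n → ℕ → Set
DistLe G x y k = ∃[ ℓ ] (ℓ ≤ k × Walk G x y ℓ)

Connected : ∀ {n} → Graph n → Set
Connected G = ∀ x y → ∃[ ℓ ] Walk G x y ℓ

HasCycle : ∀ {n} → Graph n → Set
HasCycle G = ∃[ x ] ∃[ ys ] (2 ≤ length ys × Unique (x ∷ ys)
                              × Linked (Adj G) (x ∷ ys ++ (x ∷ [])))

IsTree : ∀ {m} → Graph m → Set
IsTree T = Connected T × ¬ HasCycle T

IsLeaf : ∀ {m} → Graph m → Fin m → Set
IsLeaf T x = ∃[ y ] (Adj T x y × (∀ z → Adj T x z → z ≡ y))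

-- Standing assumption: trees have at least three leaves.
AtLeastThreeLeaves : ∀ {m} → Graph m → Set
AtLeastThreeLeaves T = ∃[ a ] ∃[ b ] ∃[ c ]
  (IsLeaf T a × IsLeaf T b × IsLeaf T c × a ≢ b × a ≢ c × b ≢ c)

IsKLeafPower : ∀ {n} → Graph n → ℕ → Set₁
IsKLeafPower {n} G k =
  ∃[ m ] Σ (Graph m) λ T → Σ (Fin n → Fin m) λ τ →
    IsTree T × AtLeastThreeLeaves T
    × Injective _≡_ _≡_ τ
    × (∀ v → IsLeaf T (τ v))
    × (∀ x → IsLeaf T x → ∃[ v ] τ v ≡ x)
    × (∀ u v → u ≢ v → (Adj G u v ⇔ DistLe T (τ u) (τ v) k))

IsLeafPower : ∀ {n} → Graph n → Set₁
IsLeafPower G = ∃[ k ] (1 ≤ k × IsKLeafPower G k)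

-- An RS model of G, recorded with its centers c_v and radii r_v:
-- S_v = ball of radius r_v around c_v in T, and for u ≠ v,
-- S_u ∩ S_v ≠ ∅ iff uv ∈ E(G).
record RSModel {n : ℕ} (G : Graph n) : Set₁ where
  field
    m       : ℕ
    T       : Graph m
    isTree  : IsTree T
    leaves3 : AtLeastThreeLeaves T
    center  : Fin n → Fin m
    radius  : Fin n → ℕ
    model   : ∀ u v → u ≢ v →
      (Adj G u v ⇔ (∃[ x ] (DistLe T (center u) x (radius u)
                          × DistLe T (center v) x (radius v))))
open RSModel public

-- Subdividing every edge of a k-leaf root T doubles all distances, so two leaves are
-- at distance at most k in T iff the balls of radius k around them in the subdivision
-- meet (in any graph, balls of radii a and b meet iff their centres are at distance at
-- most a + b).  This gives an RS model of G all of whose radii are k < r.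

module Submission where

open import Defs hiding (sym)
open import Data.Nat using (ℕ; zero; suc; _≤_; _<_; _+_; _*_; z≤n; s≤s)
open import Data.Nat.Properties
  using (+-comm; +-suc; +-mono-≤; +-mono-<; _≤?_; ≰⇒>; <⇒≱; m≤n+m; <-cmp; <-irrefl; <-asym; ≤-trans; <-≤-trans)
open import Data.Fin using (Fin; toℕ)
open import Data.Fin.Properties using (toℕ-injective; +↔⊎; *↔×)
open import Data.Sum using (_⊎_; inj₁; inj₂; fromInj₂)
open import Data.Sum.Function.Propositional using (_⊎-↔_)
open import Data.Product using (Σ; ∃-syntax; _×_; _,_)
open import Data.Empty using (⊥; ⊥-elim)
open import Data.List using (List; []; _∷_; _∷ʳ_; length; map)
open import Data.List.Properties using (length-++; length-map; map-++)
open import Data.List.Relation.Unary.All using (All; []; _∷_)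
open import Data.List.Relation.Unary.All.Properties using (∷ʳ⁺)
open import Data.List.Relation.Unary.AllPairs using ([]; _∷_)
open import Data.List.Relation.Unary.Linked using (Linked; []; [-]; _∷_; zipWith)
import Data.List.Relation.Unary.Linked.Properties as Linked
open import Data.List.Relation.Unary.Unique.Propositional using (Unique)
import Data.List.Relation.Unary.Unique.Propositional.Properties as Unique
open import Relation.Nullary using (¬_; yes; no; contradiction)
open import Relation.Binary.Definitions using (tri<; tri≈; tri>)
open import Relation.Binary.PropositionalEquality
open import Function using (_∘_)
open import Function.Bundles using (_⇔_; _↔_; mk⇔; Inverse)
import Function.Properties.Equivalence as ⇔
open import Function.Properties.Inverse using (↔-refl; ↔-trans)

module _ {n : ℕ} (G : Graph n) where

  walk-++ : ∀ {x y z a b} → Walk G x y a → Walk G y z b → Walk G x z (a + b)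
  walk-++ nil        w′ = w′
  walk-++ (cons e w) w′ = cons e (walk-++ w w′)

  walk-reverse : ∀ {x y ℓ} → Walk G x y ℓ → Walk G y x ℓ
  walk-reverse nil                = nil
  walk-reverse (cons {ℓ = ℓ} e w) =
    subst (Walk G _ _) (+-comm ℓ 1) (walk-++ (walk-reverse w) (cons (Graph.sym G e) nil))

  walk-split : ∀ {x y ℓ} a b → Walk G x y ℓ → ℓ ≤ a + b →
               ∃[ z ] (DistLe G x z a × DistLe G z y b)
  walk-split {x} {ℓ = ℓ} zero b w ℓ≤b = x , (0 , z≤n , nil) , (ℓ , ℓ≤b , w)
  walk-split {x} (suc a) b nil _ = x , (0 , z≤n , nil) , (0 , z≤n , nil)
  walk-split (suc a) b (cons e w) (s≤s ℓ≤a+b) with walk-split a b w ℓ≤a+b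
  ... | z , (ℓ₁ , ℓ₁≤a , w₁) , dzy = z , (suc ℓ₁ , s≤s ℓ₁≤a , cons e w₁) , dzy

  distLe-+⇔meet : ∀ x y a b →
                  DistLe G x y (a + b) ⇔ (∃[ z ] (DistLe G x z a × DistLe G y z b))
  distLe-+⇔meet x y a b = mk⇔ to from
    where
    to : DistLe G x y (a + b) → ∃[ z ] (DistLe G x z a × DistLe G y z b)
    to (ℓ , ℓ≤a+b , w) with walk-split a b w ℓ≤a+b
    ... | z , dxz , (ℓ₂ , ℓ₂≤b , w₂) = z , dxz , (ℓ₂ , ℓ₂≤b , walk-reverse w₂)
    from : ∃[ z ] (DistLe G x z a × DistLe G y z b) → DistLe G x y (a + b)
    from (z , (ℓ₁ , ℓ₁≤a , w₁) , (ℓ₂ , ℓ₂≤b , w₂)) =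
      ℓ₁ + ℓ₂ , +-mono-≤ ℓ₁≤a ℓ₂≤b , walk-++ w₁ (walk-reverse w₂)

m+m≤n+n⇒m≤n : ∀ {m n} → m + m ≤ n + n → m ≤ n
m+m≤n+n⇒m≤n {m} {n} m+m≤n+n with m ≤? n
... | yes m≤n = m≤n
... | no  m≰n = contradiction m+m≤n+n (<⇒≱ (+-mono-< (≰⇒> m≰n) (≰⇒> m≰n)))

unique-∷ʳ : ∀ {A : Set} {xs : List A} {x} → Unique xs → All (x ≢_) xs → Unique (xs ∷ʳ x)
unique-∷ʳ []      []         = [] ∷ []
unique-∷ʳ (p ∷ U) (x≢y ∷ x≢) = ∷ʳ⁺ p (≢-sym x≢y) ∷ unique-∷ʳ U x≢

linked-≢-closed : ∀ {A : Set} {x y : A} {ys} → Unique (x ∷ y ∷ ys) → Linked _≢_ (x ∷ y ∷ ys ∷ʳ x)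
linked-≢-closed ((x≢y ∷ x≢ys) ∷ U) = x≢y ∷ Linked.AllPairs⇒Linked (unique-∷ʳ U (x≢y ∷ x≢ys))

module _ {A : Set} (R : A → A → Set) where

  Cycle : A → List A → Set
  Cycle x ys = 2 ≤ length ys × Unique (x ∷ ys) × Linked R (x ∷ ys ∷ʳ x)

  linked-∷ʳ : ∀ xs {y z} → Linked R (xs ∷ʳ y) → R y z → Linked R (xs ∷ʳ y ∷ʳ z)
  linked-∷ʳ []           _       ryz = ryz ∷ [-]
  linked-∷ʳ (_ ∷ [])     (r ∷ L) ryz = r ∷ linked-∷ʳ [] L ryz
  linked-∷ʳ (_ ∷ x ∷ xs) (r ∷ L) ryz = r ∷ linked-∷ʳ (x ∷ xs) L ryz

  cycle-rotate : ∀ {x y ys} → Cycle x (y ∷ ys) → Cycle y (ys ∷ʳ x)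
  cycle-rotate {x} {y} {ys} (s≤s 1≤∣ys∣ , (x≢ ∷ U) , rxy ∷ L) =
    subst (2 ≤_) (sym (trans (length-++ ys) (+-comm (length ys) 1))) (s≤s 1≤∣ys∣) ,
    unique-∷ʳ U x≢ ,
    linked-∷ʳ (y ∷ ys) L rxy

data Path {V : Set} (R : V → V → Set) : V → V → ℕ → Set where
  nil  : ∀ {x} → Path R x x 0
  cons : ∀ {x y z ℓ} → R x y → Path R y z ℓ → Path R x z (suc ℓ)

module Enumerate {V : Set} (_~_ : V → V → Set)
    (~-sym : ∀ {s t} → s ~ t → t ~ s) (~-irrefl : ∀ {s} → ¬ s ~ s)
    {N : ℕ} (enumeration : Fin N ↔ V) where

  open Inverse enumeration using (to; from; strictlyInverseˡ; strictlyInverseʳ)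

  node : V → Fin N
  node = from

  graph : Graph N
  graph = record { Adj = λ i j → to i ~ to j ; sym = ~-sym ; irrefl = ~-irrefl }

  edge : ∀ {s t} → s ~ t → Adj graph (node s) (node t)
  edge {s} {t} = subst₂ _~_ (sym (strictlyInverseˡ s)) (sym (strictlyInverseˡ t))

  to-injective : ∀ {i j} → to i ≡ to j → i ≡ j
  to-injective {i} {j} eq =
    trans (sym (strictlyInverseʳ i)) (trans (cong from eq) (strictlyInverseʳ j))

  node-injective : ∀ {s t} → node s ≡ node t → s ≡ t
  node-injective {s} {t} eq =
    trans (sym (strictlyInverseˡ s)) (trans (cong to eq) (strictlyInverseˡ t))

  walk⇒path : ∀ {s t ℓ} → Walk graph (node s) (node t) ℓ → Path _~_ s t ℓ
  walk⇒path {s} {t} {ℓ} w =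
    subst₂ (λ s t → Path _~_ s t ℓ) (strictlyInverseˡ s) (strictlyInverseˡ t) (along w)
    where
    along : ∀ {i j ℓ} → Walk graph i j ℓ → Path _~_ (to i) (to j) ℓ
    along nil        = nil
    along (cons e w) = cons e (along w)

  connected : (∀ s t → ∃[ ℓ ] Walk graph (node s) (node t) ℓ) → Connected graph
  connected walk i j with walk (to i) (to j)
  ... | ℓ , w = ℓ , subst₂ (λ i j → Walk graph i j ℓ) (strictlyInverseʳ i) (strictlyInverseʳ j) w

  hasCycle⇒cycle : HasCycle graph → ∃[ s ] ∃[ ss ] Cycle _~_ s ss
  hasCycle⇒cycle (i , is , 2≤∣is∣ , U , L) =
    to i , map to is ,
    subst (2 ≤_) (sym (length-map to is)) 2≤∣is∣ ,
    Unique.map⁺ to-injective U ,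
    subst (λ l → Linked _~_ (to i ∷ l)) (map-++ to is (i ∷ [])) (Linked.map⁺ L)

  isLeaf : ∀ {s t} → s ~ t → (∀ u → s ~ u → u ≡ t) → IsLeaf graph (node s)
  isLeaf {s} {t} s~t unique =
    node t , edge s~t , λ j s~j →
      trans (sym (strictlyInverseʳ j)) (cong from (unique (to j) (subst (_~ to j) (strictlyInverseˡ s) s~j)))

module Subdivision {m : ℕ} (T : Graph m) where

  Node : Set
  Node = Fin m ⊎ (Fin m × Fin m)

  -- (x , y) is the midpoint of the edge xy when toℕ x < toℕ y; every other pair
  -- is a pendant node hanging from x, which lets Node be enumerated by Fin (m + m * m).
  Attached : Fin m → Fin m × Fin m → Set
  Attached a (x , y) = a ≡ x ⊎ (a ≡ y × Adj T x y × toℕ x < toℕ y)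

  _─_ : Node → Node → Set
  inj₁ a ─ inj₂ p = Attached a p
  inj₂ p ─ inj₁ a = Attached a p
  inj₁ _ ─ inj₁ _ = ⊥
  inj₂ _ ─ inj₂ _ = ⊥

  ─-sym : ∀ {s t} → s ─ t → t ─ s
  ─-sym {inj₁ _} {inj₂ _} s─t = s─t
  ─-sym {inj₂ _} {inj₁ _} s─t = s─t

  ─-irrefl : ∀ {s} → ¬ s ─ s
  ─-irrefl {inj₁ _} ()
  ─-irrefl {inj₂ _} ()

  enumeration : Fin (m + m * m) ↔ Node
  enumeration = ↔-trans +↔⊎ (↔-refl ⊎-↔ *↔× {m} {m})

  open Enumerate _─_ ─-sym ─-irrefl enumeration public renaming (graph to subdivision)

  original : Fin m → Fin (m + m * m)
  original a = node (inj₁ a)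

  midpoint : ∀ {x y} → Adj T x y → ∃[ p ] (Attached x p × Attached y p)
  midpoint {x} {y} e with <-cmp (toℕ x) (toℕ y)
  ... | tri< x<y _ _ = (x , y) , inj₁ refl , inj₂ (refl , e , x<y)
  ... | tri≈ _ x≡y _ = ⊥-elim (Graph.irrefl T (subst (Adj T x) (sym (toℕ-injective x≡y)) e))
  ... | tri> _ _ y<x = (y , x) , inj₂ (refl , Graph.sym T e , y<x) , inj₁ refl

  attached-adjacent : ∀ {a b p} → Attached a p → Attached b p → a ≡ b ⊎ Adj T a b
  attached-adjacent (inj₁ refl)           (inj₁ refl)           = inj₁ refl
  attached-adjacent (inj₁ refl)           (inj₂ (refl , e , _)) = inj₂ e
  attached-adjacent (inj₂ (refl , e , _)) (inj₁ refl)           = inj₂ (Graph.sym T e)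
  attached-adjacent (inj₂ (refl , _ , _)) (inj₂ (refl , _ , _)) = inj₁ refl

  subdivide : ∀ {u v ℓ} → Walk T u v ℓ → Walk subdivision (original u) (original v) (ℓ + ℓ)
  subdivide nil = nil
  subdivide (cons {x} {y} {ℓ = ℓ} e w) with midpoint e
  ... | p , xp , yp =
    cons (edge {inj₁ x} {inj₂ p} xp)
      (subst (Walk subdivision _ _) (sym (+-suc ℓ ℓ)) (cons (edge {inj₂ p} {inj₁ y} yp) (subdivide w)))

  halve : ∀ {u v ℓ} → Path _─_ (inj₁ u) (inj₁ v) ℓ → ∃[ ℓ′ ] (ℓ′ + ℓ′ ≤ ℓ × Walk T u v ℓ′)
  halve nil = 0 , z≤n , nil
  halve (cons {y = inj₁ _} () _)
  halve (cons {y = inj₂ _} _ (cons {y = inj₂ _} () _))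
  halve (cons {y = inj₂ _} ap (cons {y = inj₁ b} {ℓ = ℓ} bp w)) with halve w | attached-adjacent ap bp
  ... | ℓ′ , ℓ′+ℓ′≤ℓ , w′ | inj₁ refl = ℓ′ , ≤-trans ℓ′+ℓ′≤ℓ (m≤n+m ℓ 2) , w′
  ... | ℓ′ , ℓ′+ℓ′≤ℓ , w′ | inj₂ e    =
    suc ℓ′ , subst (_≤ 2 + ℓ) (cong suc (sym (+-suc ℓ′ ℓ′))) (s≤s (s≤s ℓ′+ℓ′≤ℓ)) , cons e w′

  distLe⇔distLe-subdivision : ∀ u v k →
    DistLe T u v k ⇔ DistLe subdivision (original u) (original v) (k + k)
  distLe⇔distLe-subdivision u v k = mk⇔ to from
    where
    to : DistLe T u v k → DistLe subdivision (original u) (original v) (k + k)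
    to (ℓ , ℓ≤k , w) = ℓ + ℓ , +-mono-≤ ℓ≤k ℓ≤k , subdivide w
    from : DistLe subdivision (original u) (original v) (k + k) → DistLe T u v k
    from (ℓ , ℓ≤k+k , w) with halve (walk⇒path w)
    ... | ℓ′ , ℓ′+ℓ′≤ℓ , w′ = ℓ′ , m+m≤n+n⇒m≤n (≤-trans ℓ′+ℓ′≤ℓ ℓ≤k+k) , w′

  anchor : Node → Fin m
  anchor (inj₁ a)       = a
  anchor (inj₂ (x , _)) = x

  walk-to-anchor : ∀ s → ∃[ ℓ ] Walk subdivision (node s) (original (anchor s)) ℓ
  walk-to-anchor (inj₁ a)       = 0 , nil
  walk-to-anchor (inj₂ (x , y)) = 1 , cons (edge {inj₂ (x , y)} {inj₁ x} (inj₁ refl)) nil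

  subdivision-connected : Connected T → Connected subdivision
  subdivision-connected conn = connected walk
    where
    walk : ∀ s t → ∃[ ℓ ] Walk subdivision (node s) (node t) ℓ
    walk s t with walk-to-anchor s | walk-to-anchor t | conn (anchor s) (anchor t)
    ... | _ , ws | _ , wt | _ , w =
      _ , walk-++ subdivision ws (walk-++ subdivision (subdivide w) (walk-reverse subdivision wt))

  attached-to-both : ∀ {a b p} → a ≢ b → Attached a p → Attached b p →
    (p ≡ (a , b) × toℕ a < toℕ b) ⊎ (p ≡ (b , a) × toℕ b < toℕ a)
  attached-to-both a≢b (inj₁ refl)             (inj₁ refl)             = ⊥-elim (a≢b refl)
  attached-to-both a≢b (inj₁ refl)             (inj₂ (refl , _ , a<b)) = inj₁ (refl , a<b)
  attached-to-both a≢b (inj₂ (refl , _ , b<a)) (inj₁ refl)             = inj₂ (refl , b<a)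
  attached-to-both a≢b (inj₂ (refl , _ , _))   (inj₂ (refl , _ , _))   = ⊥-elim (a≢b refl)

  midpoint-unique : ∀ {a b p q} → a ≢ b →
    Attached a p → Attached b p → Attached a q → Attached b q → p ≡ q
  midpoint-unique a≢b ap bp aq bq with attached-to-both a≢b ap bp | attached-to-both a≢b aq bq
  ... | inj₁ (refl , _)   | inj₁ (refl , _)   = refl
  ... | inj₂ (refl , _)   | inj₂ (refl , _)   = refl
  ... | inj₁ (_ , a<b)    | inj₂ (_ , b<a)    = ⊥-elim (<-asym a<b b<a)
  ... | inj₂ (_ , b<a)    | inj₁ (_ , a<b)    = ⊥-elim (<-asym a<b b<a)

  originals : List Node → List (Fin m)
  originals []           = []
  originals (inj₁ a ∷ ss) = a ∷ originals ss
  originals (inj₂ _ ∷ ss) = originals ss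

  originals-∷ʳ : ∀ ss a → originals (ss ∷ʳ inj₁ a) ≡ originals ss ∷ʳ a
  originals-∷ʳ []            a = refl
  originals-∷ʳ (inj₁ b ∷ ss) a = cong (b ∷_) (originals-∷ʳ ss a)
  originals-∷ʳ (inj₂ _ ∷ ss) a = originals-∷ʳ ss a

  originals-All≢ : ∀ {a ss} → All (inj₁ a ≢_) ss → All (a ≢_) (originals ss)
  originals-All≢ {ss = []}          []          = []
  originals-All≢ {ss = inj₁ _ ∷ _} (a≢b ∷ a≢) = (a≢b ∘ cong inj₁) ∷ originals-All≢ a≢
  originals-All≢ {ss = inj₂ _ ∷ _} (_ ∷ a≢)   = originals-All≢ a≢

  originals-unique : ∀ {ss} → Unique ss → Unique (originals ss)
  originals-unique {[]}          []      = []
  originals-unique {inj₁ _ ∷ _} (p ∷ U) = originals-All≢ p ∷ originals-unique U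
  originals-unique {inj₂ _ ∷ _} (_ ∷ U) = originals-unique U

  originals-linked : ∀ {a} ss → Linked _─_ (inj₁ a ∷ ss) →
                     Linked (λ u w → u ≢ w → Adj T u w) (a ∷ originals ss)
  originals-linked []                     _              = [-]
  originals-linked (inj₁ _ ∷ _)           (() ∷ _)
  originals-linked (inj₂ _ ∷ [])          _              = [-]
  originals-linked (inj₂ _ ∷ inj₂ _ ∷ _)  (_ ∷ () ∷ _)
  originals-linked (inj₂ _ ∷ inj₁ _ ∷ ss) (ap ∷ bp ∷ L) =
    (λ a≢b → fromInj₂ (⊥-elim ∘ a≢b) (attached-adjacent ap bp)) ∷ originals-linked ss L

  cycle-at-original : ∀ a ss → Cycle _─_ (inj₁ a) ss → HasCycle T
  cycle-at-original a []                                     (() , _)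
  cycle-at-original a (_ ∷ [])                               (s≤s () , _)
  cycle-at-original a (inj₁ _ ∷ _)                           (_ , _ , () ∷ _)
  cycle-at-original a (inj₂ _ ∷ inj₂ _ ∷ _)                  (_ , _ , _ ∷ () ∷ _)
  cycle-at-original a (inj₂ _ ∷ inj₁ _ ∷ [])                 (_ , _ , _ ∷ _ ∷ () ∷ _)
  cycle-at-original a (inj₂ _ ∷ inj₁ _ ∷ inj₁ _ ∷ _)         (_ , _ , _ ∷ _ ∷ () ∷ _)
  cycle-at-original a (inj₂ _ ∷ inj₁ _ ∷ inj₂ _ ∷ inj₂ _ ∷ _) (_ , _ , _ ∷ _ ∷ _ ∷ () ∷ _)
  cycle-at-original a (inj₂ _ ∷ inj₁ _ ∷ inj₂ _ ∷ [])
    (_ , (_ ∷ a≢b ∷ _) ∷ (_ ∷ p≢q ∷ []) ∷ _ , ap ∷ bp ∷ bq ∷ aq ∷ [-]) =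
    ⊥-elim (p≢q (cong inj₂ (midpoint-unique (a≢b ∘ cong inj₁) ap bp aq bq)))
  cycle-at-original a ss@(inj₂ _ ∷ inj₁ _ ∷ inj₂ _ ∷ inj₁ _ ∷ _) (_ , U , L) =
    a , originals ss , s≤s (s≤s z≤n) , originals-unique U ,
    zipWith (λ (adj , a≢b) → adj a≢b) (linked-if-distinct , linked-≢-closed (originals-unique U))
    where
    linked-if-distinct : Linked (λ u w → u ≢ w → Adj T u w) (a ∷ originals ss ∷ʳ a)
    linked-if-distinct = subst (λ os → Linked (λ u w → u ≢ w → Adj T u w) (a ∷ os))
                               (originals-∷ʳ ss a) (originals-linked (ss ∷ʳ inj₁ a) L)

  subdivision-cycle : ∀ s ss → Cycle _─_ s ss → HasCycle T
  subdivision-cycle (inj₁ a) ss            C                = cycle-at-original a ss C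
  subdivision-cycle (inj₂ _) []            (() , _)
  subdivision-cycle (inj₂ _) (inj₂ _ ∷ _)  (_ , _ , () ∷ _)
  subdivision-cycle (inj₂ p) (inj₁ b ∷ ss) C                =
    cycle-at-original b (ss ∷ʳ inj₂ p) (cycle-rotate _─_ C)

  subdivision-acyclic : ¬ HasCycle T → ¬ HasCycle subdivision
  subdivision-acyclic acyclic C with hasCycle⇒cycle C
  ... | s , ss , C′ = acyclic (subdivision-cycle s ss C′)

  pendant : Fin m → Fin (m + m * m)
  pendant a = node (inj₂ (a , a))

  pendant-isLeaf : ∀ a → IsLeaf subdivision (pendant a)
  pendant-isLeaf a = isLeaf {inj₂ (a , a)} {inj₁ a} (inj₁ refl) only-neighbour
    where
    only-neighbour : ∀ s → inj₂ (a , a) ─ s → s ≡ inj₁ a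
    only-neighbour (inj₁ _) (inj₁ refl)             = refl
    only-neighbour (inj₁ _) (inj₂ (refl , _ , a<a)) = ⊥-elim (<-irrefl refl a<a)

  pendant-injective : ∀ {a b} → pendant a ≡ pendant b → a ≡ b
  pendant-injective {a} {b} eq with node-injective {inj₂ (a , a)} {inj₂ (b , b)} eq
  ... | refl = refl

  subdivision-threeLeaves : AtLeastThreeLeaves T → AtLeastThreeLeaves subdivision
  subdivision-threeLeaves (a , b , c , _ , _ , _ , a≢b , a≢c , b≢c) =
    pendant a , pendant b , pendant c ,
    pendant-isLeaf a , pendant-isLeaf b , pendant-isLeaf c ,
    a≢b ∘ pendant-injective , a≢c ∘ pendant-injective , b≢c ∘ pendant-injective

kLeafPower⇒RSModel : ∀ {n} {G : Graph n} {k} →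
  IsKLeafPower G k → Σ (RSModel G) λ M → ∀ v → radius M v ≡ k
kLeafPower⇒RSModel {k = k} (m , T , τ , (conn , acyclic) , threeLeaves , _ , _ , _ , adj⇔dist) =
  record
    { m       = m + m * m
    ; T       = subdivision
    ; isTree  = subdivision-connected conn , subdivision-acyclic acyclic
    ; leaves3 = subdivision-threeLeaves threeLeaves
    ; center  = original ∘ τ
    ; radius  = λ _ → k
    ; model   = λ u v u≢v →
        ⇔.trans (adj⇔dist u v u≢v)
          (⇔.trans (distLe⇔distLe-subdivision (τ u) (τ v) k)
                   (distLe-+⇔meet subdivision (original (τ u)) (original (τ v)) k k))
    } ,
  λ _ → refl
  where open Subdivision T

corollary1 : ∀ {n} (G : Graph n) → IsLeafPower G → (r : ℕ)
    → (∀ (M : RSModel G) → ∃[ v ] r ≤ radius M v)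
    → ∀ k → 1 ≤ k → k < r → ¬ IsKLeafPower G k
corollary1 G _ r large-radius k _ k<r kLeafPower with kLeafPower⇒RSModel kLeafPower
... | M , radius≡k with large-radius M
... | v , r≤radius = <-irrefl refl (<-≤-trans k<r (subst (r ≤_) (radius≡k v) r≤radius))
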